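{- Let $\pi$ be a Gaussian prime that is odd (i.e. not divisible by $1+i$), and let $m\ge 0$ be a rational integer. Then $\sigma(\pi^m)$ is even if and only if $m$ is odd.
   Context: $\mathbb{Z}[i]$ denotes the Gaussian integers. A Gaussian integer is called even if it is divisible by $1+i$, and odd otherwise. The sum-of-divisors function (Spira) is defined as follows: write a nonzero Gaussian integer as $\eta=\varepsilon\prod_i \pi_i^{k_i}$ with $\varepsilon\in\{\pm1,\pm i\}$ a unit and each $\pi_i$ a Gaussian prime in the first quadrant ($\mathrm{Re}(\pi_i)>0$, $\mathrm{Im}(\pi_i)\ge 0$), pairwise non-associate; then $\sigma(\eta)=\prod_i \frac{\pi_i^{k_i+1}-1}{\pi_i-1}$. In particular, for a prime $\pi$ with first-quadrant associate $\pi'$, $\sigma(\pi^m)=1+\pi'+\pi'^2+\cdots+\pi'^m$. -}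

module Defs where

open import Data.Integer as ℤ using (ℤ; +_; +0; 0ℤ; 1ℤ)
open import Data.Integer.Properties using () renaming (_<?_ to _<ℤ?_; _≤?_ to _≤ℤ?_)
open import Data.Nat using (ℕ; zero; suc)
import Data.Nat
open import Data.Product using (Σ; ∃; _×_; _,_)
open import Data.Sum using (_⊎_)
open import Relation.Nullary using (¬_; yes; no)
open import Relation.Binary.PropositionalEquality using (_≡_)

record 𝔾 : Set where
  constructor _+_i
  field
    re : ℤ
    im : ℤ
open 𝔾 public

infixl 6 _+ᵍ_
infixl 7 _*ᵍ_

_+ᵍ_ : 𝔾 → 𝔾 → 𝔾
(a + b i) +ᵍ (c + d i) = (a ℤ.+ c) + (b ℤ.+ d) i

_*ᵍ_ : 𝔾 → 𝔾 → 𝔾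
(a + b i) *ᵍ (c + d i) = (a ℤ.* c ℤ.- b ℤ.* d) + (a ℤ.* d ℤ.+ b ℤ.* c) i

0ᵍ 1ᵍ iᵍ 1+iᵍ : 𝔾
0ᵍ = 0ℤ + 0ℤ i
1ᵍ = 1ℤ + 0ℤ i
iᵍ = 0ℤ + 1ℤ i
1+iᵍ = 1ℤ + 1ℤ i

-ᵍ_ : 𝔾 → 𝔾
-ᵍ (a + b i) = (ℤ.- a) + (ℤ.- b) i

_^ᵍ_ : 𝔾 → ℕ → 𝔾
z ^ᵍ zero = 1ᵍ
z ^ᵍ suc n = z *ᵍ (z ^ᵍ n)

_∣ᵍ_ : 𝔾 → 𝔾 → Set
a ∣ᵍ b = ∃ λ k → b ≡ a *ᵍ k

IsUnit : 𝔾 → Set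
IsUnit u = ∃ λ v → u *ᵍ v ≡ 1ᵍ

record GaussianPrime (p : 𝔾) : Set where
  field
    nonzero : ¬ (p ≡ 0ᵍ)
    nonunit : ¬ IsUnit p
    prime   : ∀ a b → p ∣ᵍ (a *ᵍ b) → p ∣ᵍ a ⊎ p ∣ᵍ b

Even : 𝔾 → Set
Even z = 1+iᵍ ∣ᵍ z

Odd : 𝔾 → Set
Odd z = ¬ Even z

-- the associate of z lying in the first quadrant (Re > 0, Im ≥ 0),
-- for z ≠ 0 (for z = 0 it returns 0).
firstQuadrant : 𝔾 → 𝔾
firstQuadrant (a + b i) with 0ℤ ℤ.<? a | 0ℤ ℤ.≤? b
... | yes _ | yes _ = a + b i
... | yes _ | no  _ = (ℤ.- b) + a i                -- Re>0, Im<0 : multiply by i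
... | no  _ | _ with 0ℤ ℤ.<? b
...   | yes _ = b + (ℤ.- a) i                      -- Re≤0, Im>0 : multiply by -i
...   | no  _ with a ℤ.<? 0ℤ
...     | yes _ = (ℤ.- a) + (ℤ.- b) i              -- Re<0, Im≤0 : multiply by -1
...     | no  _ = (ℤ.- b) + a i                    -- Re=0, Im≤0 : multiply by i

geomSum : 𝔾 → ℕ → 𝔾
geomSum x zero = 1ᵍ
geomSum x (suc m) = geomSum x m +ᵍ (x ^ᵍ suc m)

-- Spira's σ on a prime power: σ(π^m) = 1 + π' + ... + π'^m, π' first-quadrant associate
σPrimePow : 𝔾 → ℕ → 𝔾
σPrimePow π m = geomSum (firstQuadrant π) m

OddNat : ℕ → Set
OddNat m = ∃ λ k → m ≡ suc (k Data.Nat.+ k)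

-- Reduction modulo 1 + i is a ring homomorphism ℤ[i] → ℤ[i]/(1 + i) ≅ 𝔽₂, sending
-- a + b i to a + b mod 2; its kernel is exactly the even Gaussian integers. Units map
-- to 1, so the first-quadrant associate π' of an odd prime π maps to 1, and so do all
-- its powers. Hence σ(π^m) = 1 + π' + ⋯ + π'^m maps to m + 1 mod 2, which vanishes
-- exactly when m is odd.
module Submission where

open import Defs
open import Data.Nat using (ℕ)
open import Function.Bundles using (_⇔_)

open import Data.Nat.Base as ℕ using (zero; suc; parity)
import Data.Nat.Properties as ℕ
open import Data.Integer.Base as ℤ using (ℤ; +_; -[1+_]; ∣_∣; _⊖_; 0ℤ; 1ℤ)
import Data.Integer.Properties as ℤ
open import Data.Integer.Tactic.RingSolver using (solve-∀)
open import Data.Parity.Base as ℙ using (Parity; 0ℙ; 1ℙ; _⁻¹)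
import Data.Parity.Properties as ℙ
open import Data.Product using (∃; _,_)
open import Data.Empty using (⊥-elim)
open import Function.Base using (_∘_)
open import Function.Bundles using (mk⇔; Equivalence)
open import Function.Properties.Equivalence using (⇔-setoid)
open import Level using (0ℓ)
open import Relation.Binary.PropositionalEquality
import Relation.Binary.Reasoning.Setoid as SetoidReasoning
open import Relation.Nullary using (yes; no)
open import Algebra.Solver.Ring.AlmostCommutativeRing using (fromCommutativeRing)
open import Algebra.Solver.Ring.Simple (fromCommutativeRing ℙ.+-*-commutativeRing) ℙ._≟_
  using (solve; _:+_; _:*_; _:=_)
open import Algebra.Properties.CommutativeSemigroup ℙ.+-commutativeSemigroup using (interchange)

parity-double : ∀ n → parity (n ℕ.+ n) ≡ 0ℙ
parity-double n = trans (ℙ.+-homo-+ n n) (ℙ.p+p≡0ℙ (parity n))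

parity≡0ℙ⇒double : ∀ n → parity n ≡ 0ℙ → ∃ λ h → n ≡ h ℕ.+ h
parity≡0ℙ⇒double zero          _  = 0 , refl
parity≡0ℙ⇒double (suc zero)    ()
parity≡0ℙ⇒double (suc (suc n)) eq with parity≡0ℙ⇒double n eq
... | h , refl = suc h , cong suc (sym (ℕ.+-suc h h))

parity-suc : ∀ n → parity (suc n) ≡ parity n ⁻¹
parity-suc n = sym (ℙ.⁻¹-selfInverse (ℙ.suc-homo-⁻¹ n))

parity-suc-+-suc : ∀ m n → parity (suc m) ℙ.+ parity (suc n) ≡ parity m ℙ.+ parity n
parity-suc-+-suc m n = begin
  parity (suc m) ℙ.+ parity (suc n)  ≡⟨ ℙ.+-homo-+ (suc m) (suc n) ⟨
  parity (suc (m ℕ.+ suc n))         ≡⟨ cong (parity ∘ suc) (ℕ.+-suc m n) ⟩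
  parity (m ℕ.+ n)                   ≡⟨ ℙ.+-homo-+ m n ⟩
  parity m ℙ.+ parity n              ∎
  where open ≡-Reasoning

parity-suc≡0ℙ⇔parity≡1ℙ : ∀ m → parity (suc m) ≡ 0ℙ ⇔ parity m ≡ 1ℙ
parity-suc≡0ℙ⇔parity≡1ℙ m = mk⇔
  (λ eq → trans (sym (ℙ.suc-homo-⁻¹ m)) (cong _⁻¹ eq))
  (λ eq → trans (parity-suc m) (cong _⁻¹ eq))

OddNat⇔parity≡1ℙ : ∀ m → OddNat m ⇔ parity m ≡ 1ℙ
OddNat⇔parity≡1ℙ m = mk⇔ to from
  where
  to : ∀ {m} → OddNat m → parity m ≡ 1ℙ
  to (k , refl) = trans (parity-suc (k ℕ.+ k)) (cong _⁻¹ (parity-double k))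
  from : ∀ {m} → parity m ≡ 1ℙ → OddNat m
  from {zero}  ()
  from {suc m} eq with parity≡0ℙ⇒double m (trans (sym (ℙ.suc-homo-⁻¹ m)) (cong _⁻¹ eq))
  ... | h , refl = h , refl

parityℤ : ℤ → Parity
parityℤ x = parity ∣ x ∣

parityℤ-neg : ∀ x → parityℤ (ℤ.- x) ≡ parityℤ x
parityℤ-neg x = cong parity (ℤ.∣-i∣≡∣i∣ x)

parity-⊖ : ∀ m n → parity ∣ m ⊖ n ∣ ≡ parity m ℙ.+ parity n
parity-⊖ m       zero    = sym (ℙ.+-identityʳ (parity m))
parity-⊖ zero    (suc n) = refl
parity-⊖ (suc m) (suc n) = begin
  parity ∣ suc m ⊖ suc n ∣           ≡⟨ cong (parity ∘ ∣_∣) (ℤ.[1+m]⊖[1+n]≡m⊖n m n) ⟩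
  parity ∣ m ⊖ n ∣                   ≡⟨ parity-⊖ m n ⟩
  parity m ℙ.+ parity n              ≡⟨ parity-suc-+-suc m n ⟨
  parity (suc m) ℙ.+ parity (suc n)  ∎
  where open ≡-Reasoning

parityℤ-+ : ∀ x y → parityℤ (x ℤ.+ y) ≡ parityℤ x ℙ.+ parityℤ y
parityℤ-+ (+ m)    (+ n)    = ℙ.+-homo-+ m n
parityℤ-+ (+ m)    -[1+ n ] = parity-⊖ m (suc n)
parityℤ-+ -[1+ m ] (+ n)    = trans (parity-⊖ n (suc m)) (ℙ.+-comm (parity n) _)
parityℤ-+ -[1+ m ] -[1+ n ] = trans (ℙ.+-homo-+ m n) (sym (parity-suc-+-suc m n))

parityℤ-- : ∀ x y → parityℤ (x ℤ.- y) ≡ parityℤ x ℙ.+ parityℤ y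
parityℤ-- x y = trans (parityℤ-+ x (ℤ.- y)) (cong (parityℤ x ℙ.+_) (parityℤ-neg y))

parityℤ-* : ∀ x y → parityℤ (x ℤ.* y) ≡ parityℤ x ℙ.* parityℤ y
parityℤ-* x y = trans (cong parity (ℤ.abs-* x y)) (ℙ.*-homo-* ∣ x ∣ ∣ y ∣)

parityℤ≡0ℙ⇒double : ∀ x → parityℤ x ≡ 0ℙ → ∃ λ h → x ≡ h ℤ.+ h
parityℤ≡0ℙ⇒double (+ n) eq with parity≡0ℙ⇒double n eq
... | h , refl = + h , refl
parityℤ≡0ℙ⇒double -[1+ n ] eq with parity≡0ℙ⇒double (suc n) eq
... | h , n+1≡h+h = ℤ.- + h , trans (cong (ℤ.-_ ∘ +_) n+1≡h+h) (ℤ.neg-distrib-+ (+ h) (+ h))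

parityᵍ : 𝔾 → Parity
parityᵍ (a + b i) = parityℤ a ℙ.+ parityℤ b

parityᵍ-+ : ∀ z w → parityᵍ (z +ᵍ w) ≡ parityᵍ z ℙ.+ parityᵍ w
parityᵍ-+ (a + b i) (c + d i) =
  trans (cong₂ ℙ._+_ (parityℤ-+ a c) (parityℤ-+ b d))
        (interchange (parityℤ a) (parityℤ c) (parityℤ b) (parityℤ d))

parityᵍ-* : ∀ z w → parityᵍ (z *ᵍ w) ≡ parityᵍ z ℙ.* parityᵍ w
parityᵍ-* (a + b i) (c + d i) = begin
  parityℤ (a ℤ.* c ℤ.- b ℤ.* d) ℙ.+ parityℤ (a ℤ.* d ℤ.+ b ℤ.* c)
    ≡⟨ cong₂ ℙ._+_ (parityℤ-- (a ℤ.* c) (b ℤ.* d)) (parityℤ-+ (a ℤ.* d) (b ℤ.* c)) ⟩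
  (parityℤ (a ℤ.* c) ℙ.+ parityℤ (b ℤ.* d)) ℙ.+ (parityℤ (a ℤ.* d) ℙ.+ parityℤ (b ℤ.* c))
    ≡⟨ cong₂ ℙ._+_ (cong₂ ℙ._+_ (parityℤ-* a c) (parityℤ-* b d))
                   (cong₂ ℙ._+_ (parityℤ-* a d) (parityℤ-* b c)) ⟩
  ((A ℙ.* C) ℙ.+ (B ℙ.* D)) ℙ.+ ((A ℙ.* D) ℙ.+ (B ℙ.* C))
    ≡⟨ solve 4 (λ A B C D → (A :* C :+ B :* D) :+ (A :* D :+ B :* C) := (A :+ B) :* (C :+ D))
             refl A B C D ⟩
  (A ℙ.+ B) ℙ.* (C ℙ.+ D)
    ∎
  where
  open ≡-Reasoning
  A = parityℤ a; B = parityℤ b; C = parityℤ c; D = parityℤ d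

Even⇔parityᵍ≡0ℙ : ∀ z → Even z ⇔ parityᵍ z ≡ 0ℙ
Even⇔parityᵍ≡0ℙ z = mk⇔ to from
  where
  to : ∀ {z} → Even z → parityᵍ z ≡ 0ℙ
  to (k , refl) = parityᵍ-* 1+iᵍ k
  -- If a + b = 2h then a + b i = (1 + i)(h + (h - a) i).
  from : ∀ {z} → parityᵍ z ≡ 0ℙ → Even z
  from {a + b i} eq with parityℤ≡0ℙ⇒double (a ℤ.+ b) (trans (parityℤ-+ a b) eq)
  ... | h , a+b≡h+h = h + (h ℤ.- a) i , cong₂ _+_i (re-eq a h) im-eq
    where
    re-eq : ∀ x y → x ≡ 1ℤ ℤ.* y ℤ.- 1ℤ ℤ.* (y ℤ.- x)
    re-eq = solve-∀
    subtract-left : ∀ x y → y ≡ (x ℤ.+ y) ℤ.- x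
    subtract-left = solve-∀
    im-eq-rearranged : ∀ x y → (y ℤ.+ y) ℤ.- x ≡ 1ℤ ℤ.* (y ℤ.- x) ℤ.+ 1ℤ ℤ.* y
    im-eq-rearranged = solve-∀
    im-eq : b ≡ 1ℤ ℤ.* (h ℤ.- a) ℤ.+ 1ℤ ℤ.* h
    im-eq = begin
      b                               ≡⟨ subtract-left a b ⟩
      (a ℤ.+ b) ℤ.- a                 ≡⟨ cong (ℤ._- a) a+b≡h+h ⟩
      (h ℤ.+ h) ℤ.- a                 ≡⟨ im-eq-rearranged a h ⟩
      1ℤ ℤ.* (h ℤ.- a) ℤ.+ 1ℤ ℤ.* h  ∎
      where open ≡-Reasoning

odd⇒parityᵍ≡1ℙ : ∀ {z} → Odd z → parityᵍ z ≡ 1ℙ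
odd⇒parityᵍ≡1ℙ {z} z-odd with parityᵍ z in eq
... | 0ℙ = ⊥-elim (z-odd (Equivalence.from (Even⇔parityᵍ≡0ℙ z) eq))
... | 1ℙ = refl

parityᵍ-rotate : ∀ a b → parityᵍ ((ℤ.- b) + a i) ≡ parityᵍ (a + b i)
parityᵍ-rotate a b = trans (cong (ℙ._+ parityℤ a) (parityℤ-neg b)) (ℙ.+-comm (parityℤ b) (parityℤ a))

parityᵍ-firstQuadrant : ∀ z → parityᵍ (firstQuadrant z) ≡ parityᵍ z
parityᵍ-firstQuadrant (a + b i) with 0ℤ ℤ.<? a | 0ℤ ℤ.≤? b
... | yes _ | yes _ = refl
... | yes _ | no  _ = parityᵍ-rotate a b
... | no  _ | _ with 0ℤ ℤ.<? b
...   | yes _ = trans (cong (parityℤ b ℙ.+_) (parityℤ-neg a)) (ℙ.+-comm (parityℤ b) (parityℤ a))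
...   | no  _ with a ℤ.<? 0ℤ
...     | yes _ = cong₂ ℙ._+_ (parityℤ-neg a) (parityℤ-neg b)
...     | no  _ = parityᵍ-rotate a b

parityᵍ-^ : ∀ x → parityᵍ x ≡ 1ℙ → ∀ n → parityᵍ (x ^ᵍ n) ≡ 1ℙ
parityᵍ-^ x x≡1 zero    = refl
parityᵍ-^ x x≡1 (suc n) = begin
  parityᵍ (x *ᵍ x ^ᵍ n)             ≡⟨ parityᵍ-* x (x ^ᵍ n) ⟩
  parityᵍ x ℙ.* parityᵍ (x ^ᵍ n)    ≡⟨ cong₂ ℙ._*_ x≡1 (parityᵍ-^ x x≡1 n) ⟩
  1ℙ                                ∎
  where open ≡-Reasoning

parityᵍ-geomSum : ∀ x → parityᵍ x ≡ 1ℙ → ∀ m → parityᵍ (geomSum x m) ≡ parity (suc m)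
parityᵍ-geomSum x x≡1 zero    = refl
parityᵍ-geomSum x x≡1 (suc m) = begin
  parityᵍ (geomSum x m +ᵍ x ^ᵍ suc m)             ≡⟨ parityᵍ-+ (geomSum x m) (x ^ᵍ suc m) ⟩
  parityᵍ (geomSum x m) ℙ.+ parityᵍ (x ^ᵍ suc m)
    ≡⟨ cong₂ ℙ._+_ (parityᵍ-geomSum x x≡1 m) (parityᵍ-^ x x≡1 (suc m)) ⟩
  parity (suc m) ℙ.+ 1ℙ                           ≡⟨ ℙ.+-comm (parity (suc m)) 1ℙ ⟩
  parity (suc m) ⁻¹                               ≡⟨ ℙ.suc-homo-⁻¹ m ⟩
  parity m                                        ∎
  where open ≡-Reasoning

mainTheorem1 : (π : 𝔾) → GaussianPrime π → Odd π → (m : ℕ) →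
    Even (σPrimePow π m) ⇔ OddNat m
mainTheorem1 π _ π-odd m = begin
  Even (σPrimePow π m)             ≈⟨ Even⇔parityᵍ≡0ℙ (σPrimePow π m) ⟩
  parityᵍ (σPrimePow π m) ≡ 0ℙ     ≡⟨ cong (_≡ 0ℙ) σ-parity ⟩
  parity (suc m) ≡ 0ℙ              ≈⟨ parity-suc≡0ℙ⇔parity≡1ℙ m ⟩
  parity m ≡ 1ℙ                    ≈⟨ OddNat⇔parity≡1ℙ m ⟨
  OddNat m                         ∎
  where
  open SetoidReasoning (⇔-setoid 0ℓ)
  σ-parity : parityᵍ (σPrimePow π m) ≡ parity (suc m)
  σ-parity = parityᵍ-geomSum (firstQuadrant π)
    (trans (parityᵍ-firstQuadrant π) (odd⇒parityᵍ≡1ℙ π-odd)) m
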